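{- Let $U$ and $V$ be countable (finite or countably infinite) sets. For every $m\in\mathbb{N}$ there exists a natural number $C'=C'(m)$ such that if $\Delta:U\times V\rightarrow\mathbb{N}$ is a colouring of the edges of the complete bipartite graph between $U$ and $V$ using at least $C'$ distinct colours, then there exist $X\subset U$ and $Y\subset V$ such that $|\Delta(X\times Y)|=m$, i.e. the complete bipartite subgraph between $X$ and $Y$ is exactly $m$-coloured. -}

module Defs where

open import Data.Nat using (ℕ)
open import Data.Fin using (Fin)
open import Data.Product using (Σ; ∃; _×_; _,_)
open import Function using (_∘_)
open import Function.Definitions using (Injective)
open import Relation.Binary.PropositionalEquality using (_≡_)

Countable : Set → Set
Countable U = Σ (U → ℕ) (Injective _≡_ _≡_)

UsesAtLeast : {U V : Set} → (U × V → ℕ) → ℕ → Set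
UsesAtLeast {U} {V} Δ k = Σ (Fin k → U × V) (λ e → Injective _≡_ _≡_ (Δ ∘ e))

-- |Δ(X × Y)| = m : the colour set of X × Y is exactly {c 0, …, c (m-1)}, c injective.
ExactlyColoured : {U V : Set} → (U × V → ℕ) → (U → Set) → (V → Set) → ℕ → Set
ExactlyColoured {U} {V} Δ X Y m =
  Σ (Fin m → ℕ) λ c →
    Injective _≡_ _≡_ c
    × (∀ u v → X u → Y v → ∃ λ i → Δ (u , v) ≡ c i)
    × (∀ i → Σ U λ u → Σ V λ v → X u × Y v × Δ (u , v) ≡ c i)

module Submission where

-- Choose C′ edges with distinct colours and index both sides by them: the colouring becomes a
-- square matrix M whose diagonal entries are pairwise distinct.  For a vertex i, pigeonhole
-- either finds m colours in row i or column i (done), or a large set of vertices on which row i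
-- is constantly x and column i constantly y.  Iterating gives a long chain i₁, i₂, … with
-- M iₖ iₗ = xₖ and M iₗ iₖ = yₖ for k < l.  Pigeonholing the xₖ and then the yₖ either gives
-- m colours in the column or row of a vertex after the chain, or a long sublist on which all
-- xₖ = x and yₖ = y.  Drop the at most two vertices with diagonal colour x or y and write the
-- rest as i₁, i₂, p, Q: the colours of (i₁ ∷ p ∷ Q) × (i₂ ∷ Q) are exactly {x, y} ∪ diag Q, so
-- taking |Q| = m − |{x, y}| gives exactly m colours.

open import Defs
open import Data.Nat using (ℕ; zero; suc; _+_; _*_; _≤_; z≤n; s≤s; s≤s⁻¹; _≟_; _≤?_)
open import Data.Nat.Properties
  using (≤-reflexive; ≤-trans; <⇒≤; ≰⇒>; +-suc; +-cancelˡ-≤; +-monoˡ-≤; m≤n⇒m⊓n≡m; n≤1+n)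
open import Data.Fin using () renaming (zero to fzero; suc to fsuc)
open import Data.Product using (Σ; ∃; ∃₂; _×_; _,_; proj₁; proj₂; uncurry) renaming (map to ×-map)
import Data.Sum as Sum
open Sum using (_⊎_; inj₁; inj₂)
open import Data.Unit using (⊤; tt)
open import Data.Bool using (true; false)
open import Data.List using (List; []; _∷_; [_]; length; map; filter; take; lookup; allFin)
open import Data.List.Properties
  using (length-map; length-take; length-tabulate; filter-accept; filter-reject; filter-all)
open import Data.List.Relation.Unary.All as All using (All; []; _∷_)
import Data.List.Relation.Unary.All.Properties as Allₚ
open import Data.List.Relation.Unary.AllPairs as AllPairs using (AllPairs; []; _∷_)
import Data.List.Relation.Unary.AllPairs.Properties as AllPairsₚ
open import Data.List.Relation.Unary.Any using (here; there; index)
open import Data.List.Relation.Unary.Any.Properties using (lookup-index)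
open import Data.List.Relation.Unary.Unique.Propositional using (Unique)
open import Data.List.Relation.Unary.Unique.Propositional.Properties using (allFin⁺)
open import Data.List.Membership.Propositional using (_∈_)
open import Data.List.Membership.Propositional.Properties using (∈-map⁺; ∈-map⁻; ∈-lookup)
import Data.List.Relation.Binary.Sublist.Propositional as Sublist
open Sublist using (_⊆_; []; _∷_; _∷ʳ_; ⊆-refl; ⊆-trans; minimum)
open import Data.List.Relation.Binary.Sublist.Propositional.Properties using (All-resp-⊆; filter-⊆)
open import Function using (_∘_; _on_; id)
open import Function.Definitions using (Injective)
open import Relation.Binary.PropositionalEquality
  using (_≡_; _≢_; refl; sym; trans; cong; subst; ≢-sym; module ≡-Reasoning)
open import Relation.Nullary using (Dec; does; yes; no; ¬?; contradiction)
open import Relation.Unary using (Decidable)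
open import Relation.Unary.Properties using (∁?)

private variable
  A B : Set

Rainbow : (A → ℕ) → List A → Set
Rainbow f = AllPairs (_≢_ on f)

AllPairs-resp-⊆ : {R : A → A → Set} {xs ys : List A} → xs ⊆ ys → AllPairs R ys → AllPairs R xs
AllPairs-resp-⊆ []         []       = []
AllPairs-resp-⊆ (_ ∷ʳ τ)   (_ ∷ rs) = AllPairs-resp-⊆ τ rs
AllPairs-resp-⊆ (refl ∷ τ) (r ∷ rs) = All-resp-⊆ τ r ∷ AllPairs-resp-⊆ τ rs

length-filter+filter-∁ : {P : A → Set} (P? : Decidable P) (xs : List A) →
                          length (filter P? xs) + length (filter (∁? P?) xs) ≡ length xs
length-filter+filter-∁ P? []       = refl
length-filter+filter-∁ P? (x ∷ xs) with ih ← length-filter+filter-∁ P? xs | does (P? x)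
... | true  = cong suc ih
... | false = trans (+-suc _ _) (cong suc ih)

Unique⇒lookup-injective : {xs : List A} → Unique xs → Injective _≡_ _≡_ (lookup xs)
Unique⇒lookup-injective (x∉ ∷ u) {fzero}  {fzero}  _ = refl
Unique⇒lookup-injective (x∉ ∷ u) {fzero}  {fsuc j} e = contradiction e (All.lookup x∉ (∈-lookup j))
Unique⇒lookup-injective (x∉ ∷ u) {fsuc i} {fzero}  e = contradiction (sym e) (All.lookup x∉ (∈-lookup i))
Unique⇒lookup-injective (x∉ ∷ u) {fsuc i} {fsuc j} e = cong fsuc (Unique⇒lookup-injective u e)

rainbow-map⁺ : {f : B → ℕ} {g : A → ℕ} {h : A → B} {W : List A} →
               All (λ w → f (h w) ≡ g w) W → Rainbow g W → Rainbow f (map h W)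
rainbow-map⁺ []       []       = []
rainbow-map⁺ {f = f} {g} {h} {w ∷ W} (e ∷ es) (r ∷ rs) =
  Allₚ.map⁺ (All.zipWith distinct (es , r)) ∷ rainbow-map⁺ es rs
  where
  distinct : ∀ {w′} → f (h w′) ≡ g w′ × g w ≢ g w′ → f (h w) ≢ f (h w′)
  distinct (e′ , gw≢gw′) fhw≡fhw′ = gw≢gw′ (trans (sym e) (trans fhw≡fhw′ e′))

colour≢? : (f : A → ℕ) (v : ℕ) → Decidable (λ a → f a ≢ v)
colour≢? f v a = ¬? (f a ≟ v)

length-filter-colour≢-rainbow : (f : A → ℕ) (v : ℕ) {xs : List A} → Rainbow f xs →
                                length xs ≤ suc (length (filter (colour≢? f v) xs))
length-filter-colour≢-rainbow f v {[]}     []         = z≤n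
length-filter-colour≢-rainbow f v {x ∷ xs} (fx∉ ∷ r) with f x ≟ v
... | yes fx≡v = s≤s (≤-reflexive (begin
      length xs                    ≡⟨ cong length (filter-all P? others≢v) ⟨
      length (filter P? xs)        ≡⟨ cong length (filter-reject P? (λ fx≢v → fx≢v fx≡v)) ⟨
      length (filter P? (x ∷ xs))  ∎))
  where
  open ≡-Reasoning
  P? = colour≢? f v
  others≢v : All (λ a → f a ≢ v) xs
  others≢v = All.map (λ fx≢fa fa≡v → fx≢fa (trans fx≡v (sym fa≡v))) fx∉
... | no fx≢v = subst (λ ys → suc (length xs) ≤ suc (length ys)) (sym (filter-accept (colour≢? f v) fx≢v))
                  (s≤s (length-filter-colour≢-rainbow f v r))

partition-by-colour : (f : A → ℕ) (v : ℕ) (T : List A) →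
  ∃₂ λ K R → K ⊆ T × R ⊆ T × All (λ t → f t ≡ v) K × All (λ t → f t ≢ v) R ×
            length K + length R ≡ length T
partition-by-colour f v T =
  filter P? T , filter (∁? P?) T , filter-⊆ P? T , filter-⊆ (∁? P?) T ,
  Allₚ.all-filter P? T , Allₚ.all-filter (∁? P?) T , length-filter+filter-∁ P? T
  where
  P? = λ t → f t ≟ v

RainbowOrMonochromatic : (A → ℕ) → ℕ → ℕ → List A → Set
RainbowOrMonochromatic {A} f m n T =
  (∃ λ W → W ⊆ T × length W ≡ m × Rainbow f W) ⊎
  (∃₂ λ v (T′ : List A) → T′ ⊆ T × All (λ t → f t ≡ v) T′ × n ≤ length T′)

m+n≤o+p⇒o≤m⇒n≤p : ∀ {n c k r} → n + c ≤ k + r → k ≤ n → c ≤ r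
m+n≤o+p⇒o≤m⇒n≤p {n} h k≤n = +-cancelˡ-≤ n _ _ (≤-trans h (+-monoˡ-≤ _ k≤n))

pigeonhole : (f : A → ℕ) (m n : ℕ) (T : List A) → m * n ≤ length T → RainbowOrMonochromatic f m n T
pigeonhole f zero    n       T       _       = inj₁ ([] , minimum T , refl , [])
pigeonhole f (suc m) zero    T       _       = inj₂ (0 , [] , minimum T , [] , z≤n)
pigeonhole f (suc m) (suc n) (t ∷ T) (s≤s h) with partition-by-colour f (f t) T
... | K , R , K⊆T , R⊆T , K-mono , R-avoids , |K|+|R| with n ≤? length K
...   | yes n≤|K| = inj₂ (f t , t ∷ K , refl ∷ K⊆T , refl ∷ K-mono , s≤s n≤|K|)
...   | no n≰|K| with pigeonhole f m (suc n) R
                      (m+n≤o+p⇒o≤m⇒n≤p (subst (_ ≤_) (sym |K|+|R|) h) (<⇒≤ (≰⇒> n≰|K|)))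
...     | inj₁ (W , τ , l , r) =
          inj₁ (t ∷ W , refl ∷ ⊆-trans τ R⊆T , cong suc l , All-resp-⊆ τ (All.map ≢-sym R-avoids) ∷ r)
...     | inj₂ (v , T′ , τ , mono , l) = inj₂ (v , T′ , t ∷ʳ ⊆-trans τ R⊆T , mono , l)

Image : (A → B) → (A → Set) → B → Set
Image f X b = ∃ λ a → X a × f a ≡ b

exactlyColoured-image : {U V : Set} (f : A → U) (g : B → V) (Δ : U × V → ℕ)
                        {X : A → Set} {Y : B → Set} {m : ℕ} →
  ExactlyColoured (Δ ∘ ×-map f g) X Y m → ExactlyColoured Δ (Image f X) (Image g Y) m
exactlyColoured-image {U = U} {V} f g Δ {X} {Y} (c , c-injective , covered , realised) =
  c , c-injective , covered′ , realised′
  where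
  covered′ : ∀ u v → Image f X u → Image g Y v → ∃ λ i → Δ (u , v) ≡ c i
  covered′ _ _ (a , Xa , refl) (b , Yb , refl) = covered a b Xa Yb
  realised′ : ∀ i → Σ U λ u → Σ V λ v → Image f X u × Image g Y v × Δ (u , v) ≡ c i
  realised′ i with realised i
  ... | a , b , Xa , Yb , e = f a , g b , (a , Xa , refl) , (b , Yb , refl) , e

chainBound : ℕ → ℕ → ℕ
chainBound m zero    = 1
chainBound m (suc k) = suc (m * (m * chainBound m k))

-- Two pigeonholes turn a chain of length m·m·n into a homogeneous list of length n; n = 4 + m
-- leaves room for the m + 2 vertices of the final submatrix and the two discarded ones.
colourBound : ℕ → ℕ
colourBound m = chainBound m (m * (m * (4 + m)))

module Submatrix {I : Set} (M : I → I → ℕ) where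

  diag : I → ℕ
  diag a = M a a

  ExactSubmatrix : ℕ → Set₁
  ExactSubmatrix m = Σ (I → Set) λ X → Σ (I → Set) λ Y → ExactlyColoured (uncurry M) X Y m

  record Palette (S T : List I) (cs : List ℕ) : Set where
    field
      covers   : ∀ {a b} → a ∈ S → b ∈ T → M a b ∈ cs
      realises : ∀ {c} → c ∈ cs → ∃₂ λ a b → a ∈ S × b ∈ T × M a b ≡ c

  palette⇒exact : ∀ {S T cs m} → Unique cs → length cs ≡ m → Palette S T cs → ExactSubmatrix m
  palette⇒exact {S} {T} {cs} u refl p =
    (_∈ S) , (_∈ T) , lookup cs , Unique⇒lookup-injective u , covered , λ i → realises (∈-lookup i)
    where
    open Palette p
    covered : ∀ a b → a ∈ S → b ∈ T → ∃ λ i → M a b ≡ lookup cs i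
    covered a b a∈S b∈T = index (covers a∈S b∈T) , lookup-index (covers a∈S b∈T)

  palette-dedup : ∀ {S T x y cs} → x ≡ y → Palette S T (x ∷ y ∷ cs) → Palette S T (x ∷ cs)
  palette-dedup {S} {T} {x} {y} {cs} x≡y p = record
    { covers   = λ a∈S b∈T → merge (covers a∈S b∈T)
    ; realises = realises ∘ split
    }
    where
    open Palette p
    merge : ∀ {c} → c ∈ x ∷ y ∷ cs → c ∈ x ∷ cs
    merge (here c≡x)         = here c≡x
    merge (there (here c≡y)) = here (trans c≡y (sym x≡y))
    merge (there (there c∈)) = there c∈
    split : ∀ {c} → c ∈ x ∷ cs → c ∈ x ∷ y ∷ cs
    split (here c≡x) = here c≡x
    split (there c∈) = there (there c∈)

  row-exact : ∀ {m} i W → Rainbow (M i) W → length W ≡ m → ExactSubmatrix m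
  row-exact i W r l = palette⇒exact (AllPairsₚ.map⁺ r) (trans (length-map (M i) W) l) record
    { covers   = λ { (here refl) b∈W → ∈-map⁺ (M i) b∈W }
    ; realises = realises
    }
    where
    realises : ∀ {c} → c ∈ map (M i) W → ∃₂ λ a b → a ∈ [ i ] × b ∈ W × M a b ≡ c
    realises c∈ with ∈-map⁻ _ c∈
    ... | b , b∈W , refl = i , b , here refl , b∈W , refl

  column-exact : ∀ {m} j W → Rainbow (λ a → M a j) W → length W ≡ m → ExactSubmatrix m
  column-exact j W r l = palette⇒exact (AllPairsₚ.map⁺ r) (trans (length-map (λ a → M a j) W) l) record
    { covers   = λ { a∈W (here refl) → ∈-map⁺ (λ a → M a j) a∈W }
    ; realises = realises
    }
    where
    realises : ∀ {c} → c ∈ map (λ a → M a j) W → ∃₂ λ a b → a ∈ W × b ∈ [ j ] × M a b ≡ c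
    realises c∈ with ∈-map⁻ _ c∈
    ... | a , a∈W , refl = a , j , a∈W , here refl , refl

  record Node : Set where
    constructor node
    field
      vertex    : I
      rowColour : ℕ
      colColour : ℕ
  open Node

  _▷_ : Node → I → Set
  node i x y ▷ j = M i j ≡ x × M j i ≡ y × diag i ≢ diag j

  Homogeneous : ℕ → ℕ → List I → Set
  Homogeneous x y = AllPairs (λ i j → node i x y ▷ j)

  homogeneous⇒rainbow : ∀ {x y L} → Homogeneous x y L → Rainbow diag L
  homogeneous⇒rainbow = AllPairs.map (λ (_ , _ , diag≢) → diag≢)

  record Chain (Q : I → Set) (k : ℕ) : Set where
    field
      nodes   : List Node
      last    : I
      length≡ : length nodes ≡ k
      ordered : AllPairs (λ n n′ → n ▷ vertex n′) nodes
      toLast  : All (_▷ last) nodes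
      inQ     : All (Q ∘ vertex) nodes
      lastInQ : Q last

  ∷-chain : ∀ {Q k i x y} → Q i → Chain (λ z → Q z × node i x y ▷ z) k → Chain Q (suc k)
  ∷-chain {i = i} {x} {y} qi c = record
    { nodes   = node i x y ∷ nodes
    ; last    = last
    ; length≡ = cong suc length≡
    ; ordered = All.map proj₂ inQ ∷ ordered
    ; toLast  = proj₂ lastInQ ∷ toLast
    ; inQ     = qi ∷ All.map proj₁ inQ
    ; lastInQ = proj₁ lastInQ
    }
    where open Chain c

  chain⇒homogeneous : ∀ {x y ns} → AllPairs (λ n n′ → n ▷ vertex n′) ns →
    All (λ n → rowColour n ≡ x) ns → All (λ n → colColour n ≡ y) ns → Homogeneous x y (map vertex ns)
  chain⇒homogeneous []      []          []          = []
  chain⇒homogeneous (n▷ ∷ o) (refl ∷ xs) (refl ∷ ys) = Allₚ.map⁺ n▷ ∷ chain⇒homogeneous o xs ys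

  module _ (m : ℕ) where

    node-or-exact : ∀ n i P → All (λ j → diag i ≢ diag j) P → m * (m * n) ≤ length P →
      ExactSubmatrix m ⊎ ∃₂ λ x y → ∃ λ R → R ⊆ P × All (node i x y ▷_) R × n ≤ length R
    node-or-exact n i P i-distinct h with pigeonhole (M i) m (m * n) P h
    ... | inj₁ (W , _ , l , r) = inj₁ (row-exact i W r l)
    ... | inj₂ (x , R , τ , row-x , h′) with pigeonhole (λ a → M a i) m n R h′
    ...   | inj₁ (W , _ , l , r) = inj₁ (column-exact i W r l)
    ...   | inj₂ (y , R′ , τ′ , col-y , h″) =
            inj₂ (x , y , R′ , ⊆-trans τ′ τ ,
                  All.zip (All-resp-⊆ τ′ row-x , All.zip (col-y , All-resp-⊆ (⊆-trans τ′ τ) i-distinct)) ,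
                  h″)

    -- In the recursive call Q also records that the new node dominates every later vertex.
    chain-or-exact : ∀ k (Q : I → Set) P → Rainbow diag P → All Q P → chainBound m k ≤ length P →
                     ExactSubmatrix m ⊎ Chain Q k
    chain-or-exact zero    Q (j ∷ _) _ (qj ∷ _) _ = inj₂ record
      { nodes = [] ; last = j ; length≡ = refl ; ordered = [] ; toLast = [] ; inQ = [] ; lastInQ = qj }
    chain-or-exact (suc k) Q (i ∷ P) (i-distinct ∷ r) (qi ∷ q) (s≤s h)
      with node-or-exact (chainBound m k) i P i-distinct h
    ... | inj₁ e = inj₁ e
    ... | inj₂ (x , y , R , τ , dominated , h′) =
          Sum.map₂ (∷-chain qi)
            (chain-or-exact k (λ z → Q z × node i x y ▷ z) R
              (AllPairs-resp-⊆ τ r) (All.zip (All-resp-⊆ τ q , dominated)) h′)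

    homogeneous-or-exact : ∀ n {Q} → Chain Q (m * (m * n)) →
      ExactSubmatrix m ⊎ ∃₂ λ x y → ∃ λ L → Homogeneous x y L × n ≤ length L
    homogeneous-or-exact n
      record { nodes = ns ; last = j ; length≡ = |ns| ; ordered = o ; toLast = ns▷j }
      with pigeonhole rowColour m (m * n) ns (≤-reflexive (sym |ns|))
    ... | inj₁ (W , τ , l , r) =
          inj₁ (column-exact j (map vertex W)
                  (rainbow-map⁺ (All.map proj₁ (All-resp-⊆ τ ns▷j)) r) (trans (length-map vertex W) l))
    ... | inj₂ (x , N , τ , row-x , h) with pigeonhole colColour m n N h
    ...   | inj₁ (W , τ′ , l , r) =
            inj₁ (row-exact j (map vertex W)
                    (rainbow-map⁺ (All.map (proj₁ ∘ proj₂) (All-resp-⊆ (⊆-trans τ′ τ) ns▷j)) r)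
                    (trans (length-map vertex W) l))
    ...   | inj₂ (y , N′ , τ′ , col-y , h′) =
            inj₂ (x , y , map vertex N′ ,
                  chain⇒homogeneous (AllPairs-resp-⊆ (⊆-trans τ′ τ) o) (All-resp-⊆ τ′ row-x) col-y ,
                  subst (n ≤_) (sym (length-map vertex N′)) h′)

  homogeneous-covers : ∀ {x y Q a b} → Homogeneous x y Q → a ∈ Q → b ∈ Q → M a b ∈ x ∷ y ∷ map diag Q
  homogeneous-covers (_ ∷ _)   (here refl) (here refl) = there (there (here refl))
  homogeneous-covers (q▷ ∷ _)  (here refl) (there b∈) = here (proj₁ (All.lookup q▷ b∈))
  homogeneous-covers (q▷ ∷ _)  (there a∈) (here refl) = there (here (proj₁ (proj₂ (All.lookup q▷ a∈))))
  homogeneous-covers {Q = q ∷ _} (_ ∷ h) (there a∈) (there b∈) =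
    Sublist.lookup (refl ∷ refl ∷ diag q ∷ʳ ⊆-refl) (homogeneous-covers h a∈ b∈)

  homogeneous-palette : ∀ {x y i₁ i₂ p Q} → Homogeneous x y (i₁ ∷ i₂ ∷ p ∷ Q) →
    Palette (i₁ ∷ p ∷ Q) (i₂ ∷ Q) (x ∷ y ∷ map diag Q)
  homogeneous-palette {x} {y} {i₁} {i₂} {p} {Q} ((i₁▷i₂ ∷ _ ∷ i₁▷Q) ∷ (i₂▷p ∷ i₂▷Q) ∷ (p▷Q ∷ h)) =
    record { covers = covers ; realises = realises }
    where
    covers : ∀ {a b} → a ∈ i₁ ∷ p ∷ Q → b ∈ i₂ ∷ Q → M a b ∈ x ∷ y ∷ map diag Q
    covers (here refl)         (here refl) = here (proj₁ i₁▷i₂)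
    covers (here refl)         (there b∈)  = here (proj₁ (All.lookup i₁▷Q b∈))
    covers (there (here refl)) (here refl) = there (here (proj₁ (proj₂ i₂▷p)))
    covers (there (here refl)) (there b∈)  = here (proj₁ (All.lookup p▷Q b∈))
    covers (there (there a∈))  (here refl) = there (here (proj₁ (proj₂ (All.lookup i₂▷Q a∈))))
    covers (there (there a∈))  (there b∈)  = homogeneous-covers h a∈ b∈
    realises : ∀ {c} → c ∈ x ∷ y ∷ map diag Q → ∃₂ λ a b → a ∈ i₁ ∷ p ∷ Q × b ∈ i₂ ∷ Q × M a b ≡ c
    realises (here refl)         = i₁ , i₂ , here refl , here refl , proj₁ i₁▷i₂
    realises (there (here refl)) = p , i₂ , there (here refl) , here refl , proj₁ (proj₂ i₂▷p)
    realises (there (there c∈)) with ∈-map⁻ diag c∈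
    ... | q , q∈Q , refl = q , q , there (there q∈Q) , there q∈Q , refl

  avoiding⇒exact : ∀ {x y} m L → Homogeneous x y L →
                   All (λ a → diag a ≢ x) L → All (λ a → diag a ≢ y) L →
                   4 + m ≤ length L → ExactSubmatrix (2 + m)
  avoiding⇒exact {x} {y} m (i₁ ∷ i₂ ∷ p ∷ rest) h@(_ ∷ _ ∷ _ ∷ h-rest)
                 (_ ∷ _ ∷ _ ∷ ≢x) (_ ∷ _ ∷ _ ∷ ≢y) (s≤s (s≤s (s≤s 1+m≤))) = by-cases (x ≟ y)
    where
    palette : ∀ k →
      Palette (i₁ ∷ p ∷ take k rest) (i₂ ∷ take k rest) (x ∷ y ∷ map diag (take k rest))
    palette k = homogeneous-palette (AllPairsₚ.take⁺ (3 + k) h)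
    unique : ∀ k → Unique (map diag (take k rest))
    unique k = AllPairsₚ.map⁺ (homogeneous⇒rainbow (AllPairsₚ.take⁺ k h-rest))
    ∉ : ∀ {v} → All (λ a → diag a ≢ v) rest → ∀ k → All (v ≢_) (map diag (take k rest))
    ∉ ≢v k = Allₚ.map⁺ (All.map ≢-sym (Allₚ.take⁺ k ≢v))
    length≡ : ∀ {k} → k ≤ length rest → length (map diag (take k rest)) ≡ k
    length≡ {k} k≤ = trans (length-map diag (take k rest)) (trans (length-take k rest) (m≤n⇒m⊓n≡m k≤))
    by-cases : Dec (x ≡ y) → ExactSubmatrix (2 + m)
    by-cases (yes x≡y) = palette⇒exact (∉ ≢x (suc m) ∷ unique (suc m)) (cong suc (length≡ 1+m≤))
                                       (palette-dedup x≡y (palette (suc m)))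
    by-cases (no x≢y)  = palette⇒exact ((x≢y ∷ ∉ ≢x m) ∷ ∉ ≢y m ∷ unique m)
                                       (cong (2 +_) (length≡ (≤-trans (n≤1+n m) 1+m≤))) (palette m)

  homogeneous⇒exact : ∀ {x y} m L → Homogeneous x y L → 6 + m ≤ length L → ExactSubmatrix (2 + m)
  homogeneous⇒exact {x} {y} m L h 6+m≤ =
    avoiding⇒exact m L₂ (AllPairsₚ.filter⁺ _ (AllPairsₚ.filter⁺ _ h))
      (Allₚ.filter⁺ _ (Allₚ.all-filter _ L)) (Allₚ.all-filter _ L₁) 4+m≤
    where
    L₁ = filter (colour≢? diag x) L
    L₂ = filter (colour≢? diag y) L₁
    4+m≤ : 4 + m ≤ length L₂
    4+m≤ = s≤s⁻¹ (≤-trans (s≤s⁻¹ (≤-trans 6+m≤ (length-filter-colour≢-rainbow diag x rainbow)))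
                          (length-filter-colour≢-rainbow diag y (AllPairsₚ.filter⁺ _ rainbow)))
      where
      rainbow = homogeneous⇒rainbow h

  exactSubmatrix : ∀ m P → Rainbow diag P → colourBound m ≤ length P → ExactSubmatrix m
  exactSubmatrix zero          (i ∷ _) _ _ = row-exact i [] [] refl
  exactSubmatrix (suc zero)    (i ∷ _) _ _ = row-exact i [ i ] ([] ∷ []) refl
  exactSubmatrix (suc (suc m)) P r bound
    with chain-or-exact (2 + m) _ (λ _ → ⊤) P r (All.universal (λ _ → tt) P) bound
  ... | inj₁ e = e
  ... | inj₂ c with homogeneous-or-exact (2 + m) (4 + (2 + m)) c
  ...   | inj₁ e = e
  ...   | inj₂ (_ , _ , L , h , 6+m≤) = homogeneous⇒exact m L h 6+m≤

exactly-coloured-subgraph : ∀ m {U V : Set} (Δ : U × V → ℕ) → UsesAtLeast Δ (colourBound m) →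
                            Σ (U → Set) λ X → Σ (V → Set) λ Y → ExactlyColoured Δ X Y m
exactly-coloured-subgraph m Δ (e , Δ∘e-injective)
  with Submatrix.exactSubmatrix (λ a b → Δ (proj₁ (e a) , proj₂ (e b))) m (allFin (colourBound m))
         (AllPairs.map (λ a≢b → a≢b ∘ Δ∘e-injective) (allFin⁺ (colourBound m)))
         (≤-reflexive (sym (length-tabulate id)))
... | X , Y , exact =
  Image (proj₁ ∘ e) X , Image (proj₂ ∘ e) Y , exactlyColoured-image (proj₁ ∘ e) (proj₂ ∘ e) Δ exact

corollary10 : (m : ℕ) → ∃ λ C′ →
    (U V : Set) → Countable U → Countable V →
    (Δ : U × V → ℕ) → UsesAtLeast Δ C′ →
    Σ (U → Set) λ X → Σ (V → Set) λ Y → ExactlyColoured Δ X Y m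
corollary10 m = colourBound m , λ U V _ _ → exactly-coloured-subgraph m
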